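{- Let $(A,P_A,Q_A)$, $(B,P_B,Q_B)$, $(C,P_C,Q_C)$ be finite strict double posets. Then $$\#\{f\in\mathrm{Mor}((A,P_A,Q_A),(B,P_B,Q_B)):(f(A),P_B\cap(f(A)\times f(A)),Q_B\cap(f(A)\times f(A)))\cong(C,P_C,Q_C)\}$$ $$=\frac{|\mathrm{Epi}((A,P_A,Q_A),(C,P_C,Q_C))|\cdot|\mathrm{RegMono}((C,P_C,Q_C),(B,P_B,Q_B))|}{|\mathrm{Aut}((C,P_C,Q_C))|},$$ and $$\#\{f\in\mathrm{Mor}((A,P_A,Q_A),(B,P_B,Q_B)):(f(A),\mathrm{Tr}(f(P_A)),\mathrm{Tr}(f(Q_A)))\cong(C,P_C,Q_C)\}$$ $$=\frac{|\mathrm{RegEpi}((A,P_A,Q_A),(C,P_C,Q_C))|\cdot|\mathrm{Mono}((C,P_C,Q_C),(B,P_B,Q_B))|}{|\mathrm{Aut}((C,P_C,Q_C))|}.$$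
   Context: A finite strict double poset is a triple $(A,P_A,Q_A)$ with $A$ finite and $P_A,Q_A$ strict partial orders; morphisms are maps preserving both strict orders, forming a category. $\mathrm{Mor},\mathrm{Mono},\mathrm{Epi},\mathrm{Aut}$ denote morphisms, monomorphisms, epimorphisms, automorphisms; $\mathrm{RegMono}$ regular monomorphisms (equalizers of some parallel pair), $\mathrm{RegEpi}$ regular epimorphisms (coequalizers of some parallel pair). For a map $f$ and a relation $R$, $f(R)=\{(f(a),f(a')):(a,a')\in R\}$, and $\mathrm{Tr}(R)$ denotes the transitive closure of $R$. -}

module Defs where

open import Level using (Level; _⊔_) renaming (suc to lsuc; zero to lzero)
open import Data.Nat using (ℕ)
open import Data.Fin using (Fin)
open import Data.Product using (Σ; ∃; ∃-syntax; _×_; _,_)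
open import Function using (_∘_; id)
open import Relation.Nullary using (¬_)
open import Relation.Binary.PropositionalEquality using (_≡_; _≗_)
open import Relation.Binary.Construct.Closure.Transitive using (TransClosure)

record DPoset : Set₁ where
  field
    n       : ℕ
    P       : Fin n → Fin n → Set
    Q       : Fin n → Fin n → Set
    P-irrefl : ∀ x → ¬ P x x
    P-trans  : ∀ {x y z} → P x y → P y z → P x z
    Q-irrefl : ∀ x → ¬ Q x x
    Q-trans  : ∀ {x y z} → Q x y → Q y z → Q x z
open DPoset public

Map : DPoset → DPoset → Set
Map A B = Fin (n A) → Fin (n B)

IsMor : (A B : DPoset) → Map A B → Set
IsMor A B f = ∀ x y → (P A x y → P B (f x) (f y)) × (Q A x y → Q B (f x) (f y))

IsMono : (A B : DPoset) → Map A B → Set₁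
IsMono A B f = IsMor A B f × (∀ (D : DPoset) (g h : Map D A) → IsMor D A g → IsMor D A h →
  (f ∘ g) ≗ (f ∘ h) → g ≗ h)

IsEpi : (A B : DPoset) → Map A B → Set₁
IsEpi A B f = IsMor A B f × (∀ (D : DPoset) (g h : Map B D) → IsMor B D g → IsMor B D h →
  (g ∘ f) ≗ (h ∘ f) → g ≗ h)

IsIso : (A B : DPoset) → Map A B → Set
IsIso A B f = IsMor A B f × (Σ (Map B A) λ g → IsMor B A g × ((g ∘ f) ≗ id) × ((f ∘ g) ≗ id))

IsAut : (C : DPoset) → Map C C → Set
IsAut C = IsIso C C

IsEqualizer : (C B D : DPoset) → Map C B → Map B D → Map B D → Set₁
IsEqualizer C B D f g h =
  IsMor C B f × ((g ∘ f) ≗ (h ∘ f)) ×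
  (∀ (E : DPoset) (k : Map E B) → IsMor E B k → (g ∘ k) ≗ (h ∘ k) →
     Σ (Map E C) λ u → IsMor E C u × ((f ∘ u) ≗ k) ×
       (∀ (u' : Map E C) → IsMor E C u' → (f ∘ u') ≗ k → u' ≗ u))

IsRegMono : (C B : DPoset) → Map C B → Set₁
IsRegMono C B f = Σ DPoset λ D → Σ (Map B D) λ g → Σ (Map B D) λ h →
  IsMor B D g × IsMor B D h × IsEqualizer C B D f g h

IsCoequalizer : (D A C : DPoset) → Map D A → Map D A → Map A C → Set₁
IsCoequalizer D A C g h f =
  IsMor A C f × ((f ∘ g) ≗ (f ∘ h)) ×
  (∀ (E : DPoset) (k : Map A E) → IsMor A E k → (k ∘ g) ≗ (k ∘ h) →
     Σ (Map C E) λ u → IsMor C E u × ((u ∘ f) ≗ k) ×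
       (∀ (u' : Map C E) → IsMor C E u' → (u' ∘ f) ≗ k → u' ≗ u))

IsRegEpi : (A C : DPoset) → Map A C → Set₁
IsRegEpi A C f = Σ DPoset λ D → Σ (Map D A) λ g → Σ (Map D A) λ h →
  IsMor D A g × IsMor D A h × IsCoequalizer D A C g h f

ImRel : ∀ {a b} → (Fin a → Fin b) → (Fin a → Fin a → Set) → Fin b → Fin b → Set
ImRel f R y y' = ∃[ x ] ∃[ x' ] (f x ≡ y × f x' ≡ y' × R x x')

-- (f(A), R, S) ≅ (C, P_C, Q_C), where R S are relations on Fin (n B) (only their
-- restriction to f(A) matters): a bijection φ : C → f(A) with P_C c c' ⇔ R (φ c) (φ c')
-- and Q_C c c' ⇔ S (φ c) (φ c').
ImageIso : (A B C : DPoset) → Map A B → (Fin (n B) → Fin (n B) → Set) →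
           (Fin (n B) → Fin (n B) → Set) → Set
ImageIso A B C f R S = Σ (Fin (n C) → Fin (n B)) λ φ →
  (∀ c c' → φ c ≡ φ c' → c ≡ c') ×
  (∀ y → ((∃[ c ] φ c ≡ y) → (∃[ x ] f x ≡ y)) × ((∃[ x ] f x ≡ y) → (∃[ c ] φ c ≡ y))) ×
  (∀ c c' → (P C c c' → R (φ c) (φ c')) × (R (φ c) (φ c') → P C c c')) ×
  (∀ c c' → (Q C c c' → S (φ c) (φ c')) × (S (φ c) (φ c') → Q C c c'))

ImageInduced : (A B C : DPoset) → Map A B → Set
ImageInduced A B C f = IsMor A B f × ImageIso A B C f (P B) (Q B)

ImageGenerated : (A B C : DPoset) → Map A B → Set
ImageGenerated A B C f = IsMor A B f ×
  ImageIso A B C f (TransClosure (ImRel f (P A))) (TransClosure (ImRel f (Q A)))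

-- HasCount S k : the set of maps Fin a → Fin b (up to pointwise equality)
-- satisfying S has exactly k elements, witnessed by a duplicate-free enumeration.
record HasCount {ℓ : Level} {a b : ℕ} (S : (Fin a → Fin b) → Set ℓ) (k : ℕ) : Set ℓ where
  field
    enum     : Fin k → (Fin a → Fin b)
    distinct : ∀ i j → enum i ≗ enum j → i ≡ j
    sound    : ∀ i → S (enum i)
    complete : ∀ f → S f → ∃[ i ] (f ≗ enum i)

{-# OPTIONS --safe #-}
module Submission where

open import Defs
open import Level using (Level; 0ℓ; _⊔_)
open import Data.Empty using (⊥; ⊥-elim)
open import Data.Fin using (Fin; zero; _↑ˡ_; _↑ʳ_; splitAt)
open import Data.Fin.Properties using (_≟_; any?; injective⇒≤; *↔×; splitAt-↑ˡ; splitAt-↑ʳ)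
open import Data.Nat using (ℕ; _*_; _+_; _≤_)
open import Data.Nat.Properties using (≤-antisym)
open import Data.Product using (Σ; ∃; _×_; _,_; proj₁; proj₂)
open import Data.Product.Properties using (,-injectiveˡ; ,-injectiveʳ)
open import Data.Sum using ([_,_]′)
open import Function using (_∘_; id; _on_; Injection; mk↣)
open import Function.Construct.Composition as Composition using (_↣-∘_)
open import Function.Definitions using (Injective; StrictlySurjective)
open import Function.Properties.Inverse using (↔⇒↣; ↔-sym)
open import Relation.Nullary using (¬_; yes; no)
open import Relation.Binary.Core using (Rel; _⇒_; _=[_]⇒_)
open import Relation.Binary.Definitions using (Transitive)
open import Relation.Binary.PropositionalEquality
  using (_≡_; _≗_; refl; sym; trans; cong; cong₂; subst₂; module ≡-Reasoning)
open import Relation.Binary.Construct.Closure.Transitive using (TransClosure; [_]; _∷_; _++_)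

-- Every f with image isomorphic to C factors as f = μ ∘ ε with ε : A → C surjective and
-- μ : C → B injective. For the order induced from B on f(A), ε ranges over the epimorphisms
-- (surjective morphisms) and μ over the regular monomorphisms (injective morphisms reflecting
-- both orders); for the orders generated by f(P_A) and f(Q_A), ε ranges over the regular
-- epimorphisms (surjective morphisms whose target orders are the transitive closures of the
-- images) and μ over the monomorphisms (injective morphisms). In both cases the diagonal of a
-- commutative square with ε on the left and μ on the right is a morphism, so two factorisations
-- of the same map differ by a unique automorphism of C. Thus Aut C acts freely on the pairs
-- (ε, μ) and its orbits are the fibres of (ε, μ) ↦ μ ∘ ε, which gives #{f} · |Aut C| = |E| · |M|.

module _ {a b} {ε : Fin a → Fin b} where

  surjective-cancelʳ : ∀ {c} {g h : Fin b → Fin c} → StrictlySurjective _≡_ ε →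
                       (g ∘ ε) ≗ (h ∘ ε) → g ≗ h
  surjective-cancelʳ ε-surj gε≗hε y with ε-surj y
  ... | x , refl = gε≗hε x

  surjective-∘ : ∀ {c} {σ : Fin b → Fin c} → StrictlySurjective _≡_ ε →
                 StrictlySurjective _≡_ σ → StrictlySurjective _≡_ (σ ∘ ε)
  surjective-∘ ε-surj σ-surj z with σ-surj z
  ... | y , refl with ε-surj y
  ...   | x , refl = x , refl

data Order : Set where
  p q : Order

order : (A : DPoset) → Order → Rel (Fin (n A)) 0ℓ
order A p = P A
order A q = Q A

order-irrefl : ∀ (A : DPoset) o x → ¬ order A o x x
order-irrefl A p = P-irrefl A
order-irrefl A q = Q-irrefl A

order-trans : ∀ (A : DPoset) o → Transitive (order A o)
order-trans A p = P-trans A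
order-trans A q = Q-trans A

monotone : ∀ {A B} {f : Map A B} → IsMor A B f → ∀ o → order A o =[ f ]⇒ order B o
monotone f-mor p = proj₁ (f-mor _ _)
monotone f-mor q = proj₂ (f-mor _ _)

module _ (A B : DPoset) where

  isMor : {f : Map A B} → (∀ o → order A o =[ f ]⇒ order B o) → IsMor A B f
  isMor f-mono x y = f-mono p , f-mono q

  isMor-resp-≗ : {f g : Map A B} → f ≗ g → IsMor A B f → IsMor A B g
  isMor-resp-≗ f≗g f-mor =
    isMor λ o r → subst₂ (order B o) (f≗g _) (f≗g _) (monotone f-mor o r)

isMor-id : (A : DPoset) → IsMor A A id
isMor-id A = isMor A A λ o r → r

isMor-∘ : ∀ A B C {f : Map A B} {g : Map B C} → IsMor A B f → IsMor B C g → IsMor A C (g ∘ f)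
isMor-∘ A B C f-mor g-mor = isMor A C λ o r → monotone {B} {C} g-mor o (monotone f-mor o r)

-- Images of relations and their transitive closures

module _ {a b} {ε : Fin a → Fin b} {R : Rel (Fin a) 0ℓ} where

  ImRel-image : ∀ {x x'} → R x x' → ImRel ε R (ε x) (ε x')
  ImRel-image r = _ , _ , refl , refl , r

  ImRel-⊆ : ∀ {ℓ} {S : Rel (Fin b) ℓ} → R =[ ε ]⇒ S → ImRel ε R ⇒ S
  ImRel-⊆ R⇒S (_ , _ , refl , refl , r) = R⇒S r

  closure-image-⊆ : ∀ {ℓ} {S : Rel (Fin b) ℓ} → R =[ ε ]⇒ S → Transitive S →
                    TransClosure (ImRel ε R) ⇒ S
  closure-image-⊆ R⇒S S-trans [ r ]      = ImRel-⊆ R⇒S r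
  closure-image-⊆ R⇒S S-trans (r ∷ rs) = S-trans (ImRel-⊆ R⇒S r) (closure-image-⊆ R⇒S S-trans rs)

  closure-image-map : ∀ {c} {g : Fin b → Fin c} {ε' : Fin a → Fin c} → (g ∘ ε) ≗ ε' →
                      TransClosure (ImRel ε R) =[ g ]⇒ TransClosure (ImRel ε' R)
  closure-image-map {g = g} {ε'} gε≗ε' = closure-image-⊆ (λ r → [ moved r ]) _++_
    where
    moved : ∀ {x x'} → R x x' → ImRel ε' R (g (ε x)) (g (ε x'))
    moved {x} {x'} r = x , x' , sym (gε≗ε' x) , sym (gε≗ε' x') , r

module _ {b c} {φ : Fin c → Fin b} (φ-injective : Injective _≡_ _≡_ φ) where

  ImRel-transitive : {T : Rel (Fin c) 0ℓ} → Transitive T → Transitive (ImRel φ T)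
  ImRel-transitive T-trans (x , y , refl , refl , t) (y' , z , φy'≡φy , refl , t')
    with refl ← φ-injective φy'≡φy = x , z , refl , refl , T-trans t t'

  ImRel-reflect : {T : Rel (Fin c) 0ℓ} → (ImRel φ T on φ) ⇒ T
  ImRel-reflect (x , x' , φx≡φd , φx'≡φd' , t)
    with refl ← φ-injective φx≡φd | refl ← φ-injective φx'≡φd' = t

  closure-image-pullback : ∀ {a} {R : Rel (Fin a) 0ℓ} {ε : Fin a → Fin c} {f : Fin a → Fin b} →
                           (φ ∘ ε) ≗ f → (TransClosure (ImRel f R) on φ) ⇒ TransClosure (ImRel ε R)
  closure-image-pullback {R = R} {ε} {f} φε≗f t = ImRel-reflect (pushed t)
    where
    lifted : R =[ f ]⇒ ImRel φ (TransClosure (ImRel ε R))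
    lifted {x} {x'} r = ε x , ε x' , φε≗f x , φε≗f x' , [ ImRel-image r ]
    pushed : TransClosure (ImRel f R) ⇒ ImRel φ (TransClosure (ImRel ε R))
    pushed = closure-image-⊆ lifted (ImRel-transitive _++_)

-- Constructions of double posets

mkDPoset : (m : ℕ) (R : Order → Rel (Fin m) 0ℓ) →
           (∀ o x → ¬ R o x x) → (∀ o → Transitive (R o)) → DPoset
mkDPoset m R R-irrefl R-trans = record
  { n = m ; P = R p ; Q = R q
  ; P-irrefl = R-irrefl p ; P-trans = R-trans p
  ; Q-irrefl = R-irrefl q ; Q-trans = R-trans q
  }

discrete : ℕ → DPoset
discrete m = mkDPoset m (λ _ _ _ → ⊥) (λ _ _ ()) (λ _ ())

discrete-isMor : ∀ B {m} {g : Fin m → Fin (n B)} → IsMor (discrete m) B g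
discrete-isMor B _ _ = (λ ()) , (λ ())

induced : (B : DPoset) {m : ℕ} → (Fin m → Fin (n B)) → DPoset
induced B r = mkDPoset _ (λ o → order B o on r) (λ o → order-irrefl B o ∘ r) (λ o → order-trans B o)

induced-isMor : ∀ X B {m} {r : Fin m → Fin (n B)} {g : Fin (n X) → Fin m} →
                IsMor X B (r ∘ g) → IsMor X (induced B r) g
induced-isMor X B rg-mor = rg-mor

induced-projection : ∀ B {m} {r : Fin m → Fin (n B)} → IsMor (induced B r) B r
induced-projection B _ _ = id , id

induced-order : ∀ B {m} {r : Fin m → Fin (n B)} o → (order B o on r) ⇒ order (induced B r) o
induced-order B p = id
induced-order B q = id

generated : (A C : DPoset) {ε : Map A C} → IsMor A C ε → DPoset
generated A C {ε} ε-mor = mkDPoset (n C) (λ o → TransClosure (ImRel ε (order A o)))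
  (λ o c r → order-irrefl C o c (closure-image-⊆ (monotone ε-mor o) (order-trans C o) r))
  (λ o → _++_)

generated-inclusion : ∀ A C {ε : Map A C} (ε-mor : IsMor A C ε) → IsMor A (generated A C ε-mor) ε
generated-inclusion A C ε-mor _ _ = (λ r → [ ImRel-image r ]) , (λ r → [ ImRel-image r ])

generated-order : ∀ A C {ε : Map A C} (ε-mor : IsMor A C ε) o →
                  order (generated A C ε-mor) o ⇒ TransClosure (ImRel ε (order A o))
generated-order A C ε-mor p = id
generated-order A C ε-mor q = id

-- Two copies of B, ordered by pulling back along the fold map. The parallel pair inl,
-- inl-on-image agrees exactly on the image of φ; it detects both surjectivity and equalisers.
module TwoCopies (B : DPoset) {m : ℕ} (φ : Fin m → Fin (n B)) where

  fold : Fin (n B + n B) → Fin (n B)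
  fold = [ id , id ]′ ∘ splitAt (n B)

  B⊎B : DPoset
  B⊎B = induced B fold

  inl : Map B B⊎B
  inl y = y ↑ˡ n B

  inl-on-image : Map B B⊎B
  inl-on-image y with any? (λ d → φ d ≟ y)
  ... | yes _ = y ↑ˡ n B
  ... | no _  = n B ↑ʳ y

  fold-inl : (fold ∘ inl) ≗ id
  fold-inl y = cong [ id , id ]′ (splitAt-↑ˡ (n B) y (n B))

  fold-inl-on-image : (fold ∘ inl-on-image) ≗ id
  fold-inl-on-image y with any? (λ d → φ d ≟ y)
  ... | yes _ = fold-inl y
  ... | no _  = cong [ id , id ]′ (splitAt-↑ʳ (n B) (n B) y)

  inl-isMor : IsMor B B⊎B inl
  inl-isMor = induced-isMor B B {r = fold} (isMor-resp-≗ B B (sym ∘ fold-inl) (isMor-id B))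

  inl-on-image-isMor : IsMor B B⊎B inl-on-image
  inl-on-image-isMor =
    induced-isMor B B {r = fold} (isMor-resp-≗ B B (sym ∘ fold-inl-on-image) (isMor-id B))

  image⇒agree : ∀ {y} → (∃ λ d → φ d ≡ y) → inl y ≡ inl-on-image y
  image⇒agree {y} hit with any? (λ d → φ d ≟ y)
  ... | yes _   = refl
  ... | no miss = ⊥-elim (miss hit)

  agree⇒image : ∀ {y} → inl y ≡ inl-on-image y → ∃ λ d → φ d ≡ y
  agree⇒image {y} eq with any? (λ d → φ d ≟ y)
  ... | yes hit = hit
  ... | no _ with () ← trans (sym (splitAt-↑ˡ (n B) y (n B)))
                             (trans (cong (splitAt (n B)) eq) (splitAt-↑ʳ (n B) (n B) y))

Reflecting : (C B : DPoset) → Map C B → Set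
Reflecting C B μ = ∀ o → (order B o on μ) ⇒ order C o

Generating : (A C : DPoset) → Map A C → Set
Generating A C ε = ∀ o → order C o ⇒ TransClosure (ImRel ε (order A o))

reflecting-isMor-cancelˡ : ∀ X Y Z {d : Map X Y} {m : Map Y Z} {u : Map X Z} →
                           Reflecting Y Z m → IsMor X Z u → (m ∘ d) ≗ u → IsMor X Y d
reflecting-isMor-cancelˡ X Y Z m-refl u-mor md≗u = isMor X Y λ o r →
  m-refl o (subst₂ (order Z o) (sym (md≗u _)) (sym (md≗u _)) (monotone u-mor o r))

generating-isMor-cancelʳ : ∀ X Y Z {e : Map X Y} {d : Map Y Z} {u : Map X Z} →
                           Generating X Y e → IsMor X Z u → (d ∘ e) ≗ u → IsMor Y Z d
generating-isMor-cancelʳ X Y Z e-gen u-mor de≗u = isMor Y Z λ o r →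
  closure-image-⊆ (λ r' → subst₂ (order Z o) (sym (de≗u _)) (sym (de≗u _)) (monotone u-mor o r'))
                  (order-trans Z o) (e-gen o r)

generating-∘ : ∀ A B C {ε : Map A B} {σ : Map B C} →
               Generating A B ε → Generating B C σ → Generating A C (σ ∘ ε)
generating-∘ A B C ε-gen σ-gen o r =
  closure-image-⊆ (λ r' → closure-image-map (λ _ → refl) (ε-gen o r')) _++_ (σ-gen o r)

module _ (C : DPoset) {σ : Map C C} (σ-aut : IsAut C σ) where

  aut⁻¹ : Map C C
  aut⁻¹ = proj₁ (proj₂ σ-aut)

  aut⁻¹∘aut : (aut⁻¹ ∘ σ) ≗ id
  aut⁻¹∘aut = proj₁ (proj₂ (proj₂ (proj₂ σ-aut)))

  aut∘aut⁻¹ : (σ ∘ aut⁻¹) ≗ id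
  aut∘aut⁻¹ = proj₂ (proj₂ (proj₂ (proj₂ σ-aut)))

  aut⁻¹-isAut : IsAut C aut⁻¹
  aut⁻¹-isAut = proj₁ (proj₂ (proj₂ σ-aut)) , σ , proj₁ σ-aut , aut∘aut⁻¹ , aut⁻¹∘aut

  aut-injective : Injective _≡_ _≡_ σ
  aut-injective {c} {c'} σc≡σc' =
    trans (sym (aut⁻¹∘aut c)) (trans (cong aut⁻¹ σc≡σc') (aut⁻¹∘aut c'))

  aut-surjective : StrictlySurjective _≡_ σ
  aut-surjective c = aut⁻¹ c , aut∘aut⁻¹ c

  aut-reflecting : Reflecting C C σ
  aut-reflecting o {c} {c'} r =
    subst₂ (order C o) (aut⁻¹∘aut c) (aut⁻¹∘aut c') (monotone (proj₁ aut⁻¹-isAut) o r)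

  aut-generating : Generating C C σ
  aut-generating o {c} {c'} r =
    [ aut⁻¹ c , aut⁻¹ c' , aut∘aut⁻¹ c , aut∘aut⁻¹ c' , monotone (proj₁ aut⁻¹-isAut) o r ]

-- Monomorphisms and regular monomorphisms

module _ (C B : DPoset) {μ : Map C B} where

  mono⇒injective : IsMono C B μ → Injective _≡_ _≡_ μ
  mono⇒injective (_ , μ-mono) {c} {c'} μc≡μc' =
    μ-mono (discrete 1) (λ _ → c) (λ _ → c') (discrete-isMor C) (discrete-isMor C)
           (λ _ → μc≡μc') zero

  injective⇒mono : IsMor C B μ → Injective _≡_ _≡_ μ → IsMono C B μ
  injective⇒mono μ-mor μ-injective = μ-mor , λ _ _ _ _ _ μa≗μb x → μ-injective (μa≗μb x)

  regMono-isMor : IsRegMono C B μ → IsMor C B μ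
  regMono-isMor (_ , _ , _ , _ , _ , μ-mor , _) = μ-mor

  regMono⇒mono : IsRegMono C B μ → IsMono C B μ
  regMono⇒mono (_ , _ , _ , _ , _ , μ-mor , gμ≗hμ , universal) = μ-mor , λ D a b a-mor b-mor μa≗μb →
    let (_ , _ , _ , unique) = universal D (μ ∘ a) (isMor-∘ D C B a-mor μ-mor) (gμ≗hμ ∘ a)
    in  λ x → trans (unique a a-mor (λ _ → refl) x) (sym (unique b b-mor (sym ∘ μa≗μb) x))

  regMono⇒injective : IsRegMono C B μ → Injective _≡_ _≡_ μ
  regMono⇒injective = mono⇒injective ∘ regMono⇒mono

  -- Test the equaliser against C ordered by pulling back along μ: the factorisation of μ
  -- through itself is the identity, and it is monotone.
  regMono⇒reflecting : IsRegMono C B μ → Reflecting C B μ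
  regMono⇒reflecting μ-reg@(_ , _ , _ , _ , _ , _ , gμ≗hμ , universal) o {c} {c'} r =
    let (u , u-mor , μu≗μ , _) = universal (induced B μ) μ (induced-projection B) gμ≗hμ
        u≗id : u ≗ id
        u≗id x = regMono⇒injective μ-reg (μu≗μ x)
    in  subst₂ (order C o) (u≗id c) (u≗id c') (monotone u-mor o (induced-order B o r))

  embedding⇒regMono : IsMor C B μ → Injective _≡_ _≡_ μ → Reflecting C B μ → IsRegMono C B μ
  embedding⇒regMono μ-mor μ-injective μ-reflecting =
    B⊎B , inl , inl-on-image , inl-isMor , inl-on-image-isMor ,
    μ-mor , (λ c → image⇒agree (c , refl)) , universal
    where
    open TwoCopies B μ
    universal : ∀ (E : DPoset) (k : Map E B) → IsMor E B k → (inl ∘ k) ≗ (inl-on-image ∘ k) →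
                Σ (Map E C) λ u → IsMor E C u × ((μ ∘ u) ≗ k) ×
                  (∀ (u' : Map E C) → IsMor E C u' → (μ ∘ u') ≗ k → u' ≗ u)
    universal E k k-mor k-agrees =
      u , reflecting-isMor-cancelˡ E C B μ-reflecting k-mor μu≗k , μu≗k ,
      λ _ _ μu'≗k e → μ-injective (trans (μu'≗k e) (sym (μu≗k e)))
      where
      u : Map E C
      u e = proj₁ (agree⇒image (k-agrees e))
      μu≗k : (μ ∘ u) ≗ k
      μu≗k e = proj₂ (agree⇒image (k-agrees e))

-- Epimorphisms and regular epimorphisms

module _ (A C : DPoset) {ε : Map A C} where

  surjective⇒epi : IsMor A C ε → StrictlySurjective _≡_ ε → IsEpi A C ε
  surjective⇒epi ε-mor ε-surjective = ε-mor , λ _ _ _ _ _ → surjective-cancelʳ ε-surjective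

  epi⇒surjective : IsEpi A C ε → StrictlySurjective _≡_ ε
  epi⇒surjective (_ , ε-epi) c =
    agree⇒image (ε-epi B⊎B inl inl-on-image inl-isMor inl-on-image-isMor
                       (λ x → image⇒agree (x , refl)) c)
    where open TwoCopies C ε

  regEpi-isMor : IsRegEpi A C ε → IsMor A C ε
  regEpi-isMor (_ , _ , _ , _ , _ , ε-mor , _) = ε-mor

  regEpi⇒epi : IsRegEpi A C ε → IsEpi A C ε
  regEpi⇒epi (_ , _ , _ , _ , _ , ε-mor , εg≗εh , universal) = ε-mor , λ D a b a-mor b-mor aε≗bε →
    let (_ , _ , _ , unique) = universal D (a ∘ ε) (isMor-∘ A C D ε-mor a-mor) (cong a ∘ εg≗εh)
    in  λ c → trans (unique a a-mor (λ _ → refl) c) (sym (unique b b-mor (sym ∘ aε≗bε) c))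

  regEpi⇒surjective : IsRegEpi A C ε → StrictlySurjective _≡_ ε
  regEpi⇒surjective = epi⇒surjective ∘ regEpi⇒epi

  -- Dually, test the coequaliser against C ordered by the closures of the images of the
  -- orders of A.
  regEpi⇒generating : IsRegEpi A C ε → Generating A C ε
  regEpi⇒generating ε-reg@(_ , _ , _ , _ , _ , ε-mor , εg≗εh , universal) o {c} {c'} r =
    let (u , u-mor , uε≗ε , _) =
          universal (generated A C ε-mor) ε (generated-inclusion A C ε-mor) εg≗εh
        u≗id : u ≗ id
        u≗id = surjective-cancelʳ (regEpi⇒surjective ε-reg) uε≗ε
    in  subst₂ (TransClosure (ImRel ε (order A o))) (u≗id c) (u≗id c')
               (generated-order A C ε-mor o (monotone u-mor o r))

  -- ε coequalises id and s ∘ ε on the discrete structure on A, for any section s of ε.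
  surjective-generating⇒regEpi : IsMor A C ε → StrictlySurjective _≡_ ε → Generating A C ε →
                                 IsRegEpi A C ε
  surjective-generating⇒regEpi ε-mor ε-surjective ε-generating =
    discrete (n A) , id , s ∘ ε , discrete-isMor A , discrete-isMor A ,
    ε-mor , (λ x → sym (εs (ε x))) , universal
    where
    s : Map C A
    s c = proj₁ (ε-surjective c)
    εs : (ε ∘ s) ≗ id
    εs c = proj₂ (ε-surjective c)
    universal : ∀ (E : DPoset) (k : Map A E) → IsMor A E k → (k ∘ id) ≗ (k ∘ (s ∘ ε)) →
                Σ (Map C E) λ u → IsMor C E u × ((u ∘ ε) ≗ k) ×
                  (∀ (u' : Map C E) → IsMor C E u' → (u' ∘ ε) ≗ k → u' ≗ u)
    universal E k k-mor k-coequalises =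
      k ∘ s , generating-isMor-cancelʳ A C E ε-generating k-mor (sym ∘ k-coequalises) ,
      sym ∘ k-coequalises ,
      λ u' _ u'ε≗k c → trans (cong u' (sym (εs c))) (u'ε≗k (s c))

module Image (A B C : DPoset) {f : Map A B} (R : Order → Rel (Fin (n B)) 0ℓ)
             (I : ImageIso A B C f (R p) (R q)) where

  embedding : Map C B
  embedding = proj₁ I

  embedding-injective : Injective _≡_ _≡_ embedding
  embedding-injective = proj₁ (proj₂ I) _ _

  private
    same-image : ∀ y → ((∃ λ c → embedding c ≡ y) → (∃ λ x → f x ≡ y)) ×
                       ((∃ λ x → f x ≡ y) → (∃ λ c → embedding c ≡ y))
    same-image = proj₁ (proj₂ (proj₂ I))

    order-iso : ∀ o c c' → (order C o c c' → R o (embedding c) (embedding c')) ×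
                           (R o (embedding c) (embedding c') → order C o c c')
    order-iso p = proj₁ (proj₂ (proj₂ (proj₂ I)))
    order-iso q = proj₂ (proj₂ (proj₂ (proj₂ I)))

  corestriction : Map A C
  corestriction x = proj₁ (proj₂ (same-image (f x)) (x , refl))

  factors : (embedding ∘ corestriction) ≗ f
  factors x = proj₂ (proj₂ (same-image (f x)) (x , refl))

  corestriction-surjective : StrictlySurjective _≡_ corestriction
  corestriction-surjective c with proj₁ (same-image (embedding c)) (c , refl)
  ... | x , fx≡φc = x , embedding-injective (trans (factors x) fx≡φc)

  embedding-order⁺ : ∀ o → order C o ⇒ (R o on embedding)
  embedding-order⁺ o = proj₁ (order-iso o _ _)

  embedding-order⁻ : ∀ o → (R o on embedding) ⇒ order C o
  embedding-order⁻ o = proj₂ (order-iso o _ _)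

imageIso-∘ : ∀ A B C (R : Order → Rel (Fin (n B)) 0ℓ) {ε : Map A C} {μ : Map C B} →
             StrictlySurjective _≡_ ε → Injective _≡_ _≡_ μ →
             (∀ o → order C o ⇒ (R o on μ)) → (∀ o → (R o on μ) ⇒ order C o) →
             ImageIso A B C (μ ∘ ε) (R p) (R q)
imageIso-∘ A B C R {ε} {μ} ε-surjective μ-injective to from =
  μ , (λ _ _ → μ-injective) , same-image , (λ _ _ → to p , from p) , (λ _ _ → to q , from q)
  where
  same-image : ∀ y → ((∃ λ c → μ c ≡ y) → (∃ λ x → μ (ε x) ≡ y)) ×
                     ((∃ λ x → μ (ε x) ≡ y) → (∃ λ c → μ c ≡ y))
  same-image y = (λ { (c , refl) → proj₁ (ε-surjective c) , cong μ (proj₂ (ε-surjective c)) })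
               , (λ { (x , μεx≡y) → ε x , μεx≡y })

-- Counting factorisations

×-injective⇒*-≤ : ∀ {m n p q} (F : Fin m × Fin n → Fin p × Fin q) →
                  Injective _≡_ _≡_ F → m * n ≤ p * q
×-injective⇒*-≤ F F-injective = injective⇒≤ (Injection.injective G)
  where G = ↔⇒↣ (↔-sym *↔×) ↣-∘ (mk↣ F-injective ↣-∘ ↔⇒↣ *↔×)

module _ {ℓ a b k} {S : (Fin a → Fin b) → Set ℓ} (H : HasCount S k) where
  open HasCount H

  index : ∀ {f} → S f → Fin k
  index {f} s = proj₁ (complete f s)

  enum-index : ∀ {f} (s : S f) → f ≗ enum (index s)
  enum-index {f} s = proj₂ (complete f s)

  index-injective : ∀ {f g} (s : S f) (t : S g) → index s ≡ index t → f ≗ g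
  index-injective s t eq x =
    trans (enum-index s x) (trans (cong (λ i → enum i x) eq) (sym (enum-index t x)))

module _ {ℓe ℓm : Level} (A B C : DPoset) (IsE : Map A C → Set ℓe) (IsM : Map C B → Set ℓm) where

  record Factorisation (f : Map A B) : Set (ℓe ⊔ ℓm) where
    constructor factorisation
    field
      e     : Map A C
      m     : Map C B
      e∈E   : IsE e
      m∈M   : IsM m
      m∘e≗f : (m ∘ e) ≗ f

  record ImageFactorisation {ℓk : Level} (IsK : Map A B → Set ℓk) : Set (ℓe ⊔ ℓm ⊔ ℓk) where
    field
      E-isMor        : ∀ {ε} → IsE ε → IsMor A C ε
      E-surjective   : ∀ {ε} → IsE ε → StrictlySurjective _≡_ ε
      M-isMor        : ∀ {μ} → IsM μ → IsMor C B μ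
      M-injective    : ∀ {μ} → IsM μ → Injective _≡_ _≡_ μ
      E-∘-aut        : ∀ {σ ε} → IsAut C σ → IsE ε → IsE (σ ∘ ε)
      M-∘-aut        : ∀ {σ μ} → IsAut C σ → IsM μ → IsM (μ ∘ σ)
      -- E is left orthogonal to M.
      diagonal-isMor : ∀ {ε μ u v d} → IsE ε → IsM μ → IsMor A C u → IsMor C B v →
                       (d ∘ ε) ≗ u → (μ ∘ d) ≗ v → IsMor C C d
      factorise      : ∀ {f} → IsK f → Factorisation f
      compose        : ∀ {ε μ} → IsE ε → IsM μ → IsK (μ ∘ ε)

module _ {ℓe ℓm ℓk : Level} {A B C : DPoset} {IsE : Map A C → Set ℓe} {IsM : Map C B → Set ℓm}
         {IsK : Map A B → Set ℓk} (F : ImageFactorisation A B C IsE IsM IsK) where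

  open ImageFactorisation F

  diagonal : ∀ {ε ε' μ μ'} → IsE ε → IsM μ' → (μ ∘ ε) ≗ (μ' ∘ ε') →
             Σ (Map C C) λ d → ((d ∘ ε) ≗ ε') × ((μ' ∘ d) ≗ μ)
  diagonal {ε} {ε'} {μ} {μ'} ε∈E μ'∈M με≗μ'ε' = ε' ∘ s , dε≗ε' , μ'd≗μ
    where
    s : Map C A
    s c = proj₁ (E-surjective ε∈E c)
    μ'd≗μ : (μ' ∘ ε' ∘ s) ≗ μ
    μ'd≗μ c = trans (sym (με≗μ'ε' (s c))) (cong μ (proj₂ (E-surjective ε∈E c)))
    dε≗ε' : (ε' ∘ s ∘ ε) ≗ ε'
    dε≗ε' x = M-injective μ'∈M (trans (μ'd≗μ (ε x)) (με≗μ'ε' x))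

  comparison : ∀ {ε ε' μ μ'} → IsE ε → IsE ε' → IsM μ → IsM μ' → (μ ∘ ε) ≗ (μ' ∘ ε') →
               Σ (Map C C) λ σ → IsAut C σ × ((σ ∘ ε) ≗ ε') × ((μ' ∘ σ) ≗ μ)
  comparison ε∈E ε'∈E μ∈M μ'∈M με≗μ'ε'
    with σ , σε≗ε' , μ'σ≗μ ← diagonal ε∈E μ'∈M με≗μ'ε'
       | τ , τε'≗ε , μτ≗μ' ← diagonal ε'∈E μ∈M (sym ∘ με≗μ'ε')
    = σ , (σ-isMor , τ , τ-isMor , τσ≗id , στ≗id) , σε≗ε' , μ'σ≗μ
    where
    σ-isMor : IsMor C C σ
    σ-isMor = diagonal-isMor ε∈E μ'∈M (E-isMor ε'∈E) (M-isMor μ∈M) σε≗ε' μ'σ≗μ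
    τ-isMor : IsMor C C τ
    τ-isMor = diagonal-isMor ε'∈E μ∈M (E-isMor ε∈E) (M-isMor μ'∈M) τε'≗ε μτ≗μ'
    τσ≗id : (τ ∘ σ) ≗ id
    τσ≗id = surjective-cancelʳ {h = id} (E-surjective ε∈E)
                                (λ x → trans (cong τ (σε≗ε' x)) (τε'≗ε x))
    στ≗id : (σ ∘ τ) ≗ id
    στ≗id = surjective-cancelʳ {h = id} (E-surjective ε'∈E)
                                (λ x → trans (cong σ (τε'≗ε x)) (σε≗ε' x))

  module Counting {k e m a} (HK : HasCount IsK k) (HE : HasCount IsE e) (HM : HasCount IsM m)
                  (HA : HasCount (IsAut C) a) where
    open HasCount
    open ≡-Reasoning

    module K (κ : Fin k) = Factorisation (factorise (sound HK κ))

    σ : Fin a → Map C C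
    σ = enum HA

    σ⁻¹ : Fin a → Map C C
    σ⁻¹ α = aut⁻¹ C (sound HA α)

    Ψ : Fin k × Fin a → Fin e × Fin m
    Ψ (κ , α) = index HE (E-∘-aut (sound HA α) (K.e∈E κ))
              , index HM (M-∘-aut (aut⁻¹-isAut C (sound HA α)) (K.m∈M κ))

    Ψ-determines-K : ∀ {κ α κ' α'} → Ψ (κ , α) ≡ Ψ (κ' , α') → enum HK κ ≗ enum HK κ'
    Ψ-determines-K {κ} {α} {κ'} {α'} Ψ≡Ψ x = begin
      enum HK κ x                        ≡⟨ K.m∘e≗f κ x ⟨
      K.m κ (K.e κ x)                    ≡⟨ cong (K.m κ) (aut⁻¹∘aut C (sound HA α) (K.e κ x)) ⟨
      K.m κ (σ⁻¹ α (σ α (K.e κ x)))      ≡⟨ index-injective HM _ _ (,-injectiveʳ Ψ≡Ψ) _ ⟩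
      K.m κ' (σ⁻¹ α' (σ α (K.e κ x)))    ≡⟨ cong (K.m κ' ∘ σ⁻¹ α')
                                                  (index-injective HE _ _ (,-injectiveˡ Ψ≡Ψ) x) ⟩
      K.m κ' (σ⁻¹ α' (σ α' (K.e κ' x)))  ≡⟨ cong (K.m κ') (aut⁻¹∘aut C (sound HA α') (K.e κ' x)) ⟩
      K.m κ' (K.e κ' x)                  ≡⟨ K.m∘e≗f κ' x ⟩
      enum HK κ' x                       ∎

    Ψ-injective : Injective _≡_ _≡_ Ψ
    Ψ-injective {κ , α} {κ' , α'} Ψ≡Ψ with refl ← distinct HK κ κ' (Ψ-determines-K Ψ≡Ψ) =
      cong (κ ,_) (distinct HA α α' (surjective-cancelʳ (E-surjective (K.e∈E κ)) σe≗σ'e))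
      where
      σe≗σ'e : (σ α ∘ K.e κ) ≗ (σ α' ∘ K.e κ)
      σe≗σ'e = index-injective HE _ _ (,-injectiveˡ Ψ≡Ψ)

    composite : Fin e → Fin m → Fin k
    composite i j = index HK (compose (sound HE i) (sound HM j))

    comparison-with-chosen : ∀ i j →
      Σ (Map C C) λ τ → IsAut C τ × ((τ ∘ enum HE i) ≗ K.e (composite i j))
                                  × ((K.m (composite i j) ∘ τ) ≗ enum HM j)
    comparison-with-chosen i j =
      comparison (sound HE i) (K.e∈E κ) (sound HM j) (K.m∈M κ)
                 (λ x → trans (enum-index HK _ x) (sym (K.m∘e≗f κ x)))
      where
      κ : Fin k
      κ = composite i j

    τ : Fin e → Fin m → Map C C
    τ i j = proj₁ (comparison-with-chosen i j)

    τ-isAut : ∀ i j → IsAut C (τ i j)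
    τ-isAut i j = proj₁ (proj₂ (comparison-with-chosen i j))

    mτ≗μ : ∀ i j → (K.m (composite i j) ∘ τ i j) ≗ enum HM j
    mτ≗μ i j = proj₂ (proj₂ (proj₂ (comparison-with-chosen i j)))

    Φ : Fin e × Fin m → Fin k × Fin a
    Φ (i , j) = composite i j , index HA (τ-isAut i j)

    Φ-determines-M : ∀ {i j i' j'} → Φ (i , j) ≡ Φ (i' , j') → enum HM j ≗ enum HM j'
    Φ-determines-M {i} {j} {i'} {j'} Φ≡Φ c = begin
      enum HM j c                         ≡⟨ mτ≗μ i j c ⟨
      K.m (composite i j) (τ i j c)       ≡⟨ cong₂ K.m (,-injectiveˡ Φ≡Φ)
                                                   (index-injective HA _ _ (,-injectiveʳ Φ≡Φ) c) ⟩
      K.m (composite i' j') (τ i' j' c)   ≡⟨ mτ≗μ i' j' c ⟩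
      enum HM j' c                        ∎

    composite-determines-E : ∀ {i i' j} → composite i j ≡ composite i' j → enum HE i ≗ enum HE i'
    composite-determines-E {i} {i'} {j} κ≡κ' x = M-injective (sound HM j) (begin
      enum HM j (enum HE i x)     ≡⟨ enum-index HK _ x ⟩
      enum HK (composite i j) x   ≡⟨ cong (λ κ → enum HK κ x) κ≡κ' ⟩
      enum HK (composite i' j) x  ≡⟨ enum-index HK _ x ⟨
      enum HM j (enum HE i' x)    ∎)

    Φ-injective : Injective _≡_ _≡_ Φ
    Φ-injective {i , j} {i' , j'} Φ≡Φ with refl ← distinct HM j j' (Φ-determines-M Φ≡Φ) =
      cong (_, j) (distinct HE i i' (composite-determines-E (,-injectiveˡ Φ≡Φ)))

  factorisation-count : ∀ {k e m a} → HasCount IsK k → HasCount IsE e → HasCount IsM m →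
                        HasCount (IsAut C) a → k * a ≡ e * m
  factorisation-count HK HE HM HA =
    ≤-antisym (×-injective⇒*-≤ Ψ Ψ-injective) (×-injective⇒*-≤ Φ Φ-injective)
    where open Counting HK HE HM HA

-- The two factorisation systems

epi-regMono-factorisation :
  ∀ A B C → ImageFactorisation A B C (IsEpi A C) (IsRegMono C B) (ImageInduced A B C)
epi-regMono-factorisation A B C = record
  { E-isMor        = proj₁
  ; E-surjective   = epi⇒surjective A C
  ; M-isMor        = regMono-isMor C B
  ; M-injective    = regMono⇒injective C B
  ; E-∘-aut        = E-∘-aut
  ; M-∘-aut        = M-∘-aut
  ; diagonal-isMor = λ _ μ-reg _ v-mor _ μd≗v →
                       reflecting-isMor-cancelˡ C C B (regMono⇒reflecting C B μ-reg) v-mor μd≗v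
  ; factorise      = factorise
  ; compose        = compose
  }
  where
  E-∘-aut : ∀ {σ ε} → IsAut C σ → IsEpi A C ε → IsEpi A C (σ ∘ ε)
  E-∘-aut σ-aut ε-epi =
    surjective⇒epi A C (isMor-∘ A C C (proj₁ ε-epi) (proj₁ σ-aut))
                       (surjective-∘ (epi⇒surjective A C ε-epi) (aut-surjective C σ-aut))

  M-∘-aut : ∀ {σ μ} → IsAut C σ → IsRegMono C B μ → IsRegMono C B (μ ∘ σ)
  M-∘-aut σ-aut μ-reg =
    embedding⇒regMono C B (isMor-∘ C C B (proj₁ σ-aut) (regMono-isMor C B μ-reg))
      (Composition.injective _≡_ _≡_ _≡_ (aut-injective C σ-aut) (regMono⇒injective C B μ-reg))
      (λ o → aut-reflecting C σ-aut o ∘ regMono⇒reflecting C B μ-reg o)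

  factorise : ∀ {f} → ImageInduced A B C f → Factorisation A B C (IsEpi A C) (IsRegMono C B) f
  factorise (f-mor , I) = factorisation corestriction embedding
    (surjective⇒epi A C corestriction-isMor corestriction-surjective)
    (embedding⇒regMono C B (isMor C B embedding-order⁺) embedding-injective embedding-order⁻)
    factors
    where
    open Image A B C (order B) I
    corestriction-isMor : IsMor A C corestriction
    corestriction-isMor = reflecting-isMor-cancelˡ A C B embedding-order⁻ f-mor factors

  compose : ∀ {ε μ} → IsEpi A C ε → IsRegMono C B μ → ImageInduced A B C (μ ∘ ε)
  compose ε-epi μ-reg = isMor-∘ A C B (proj₁ ε-epi) (regMono-isMor C B μ-reg)
    , imageIso-∘ A B C (order B) (epi⇒surjective A C ε-epi) (regMono⇒injective C B μ-reg)
                 (monotone (regMono-isMor C B μ-reg)) (regMono⇒reflecting C B μ-reg)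

regEpi-mono-factorisation :
  ∀ A B C → ImageFactorisation A B C (IsRegEpi A C) (IsMono C B) (ImageGenerated A B C)
regEpi-mono-factorisation A B C = record
  { E-isMor        = regEpi-isMor A C
  ; E-surjective   = regEpi⇒surjective A C
  ; M-isMor        = proj₁
  ; M-injective    = mono⇒injective C B
  ; E-∘-aut        = E-∘-aut
  ; M-∘-aut        = M-∘-aut
  ; diagonal-isMor = λ ε-reg _ u-mor _ dε≗u _ →
                       generating-isMor-cancelʳ A C C (regEpi⇒generating A C ε-reg) u-mor dε≗u
  ; factorise      = factorise
  ; compose        = compose
  }
  where
  E-∘-aut : ∀ {σ ε} → IsAut C σ → IsRegEpi A C ε → IsRegEpi A C (σ ∘ ε)
  E-∘-aut σ-aut ε-reg =
    surjective-generating⇒regEpi A C (isMor-∘ A C C (regEpi-isMor A C ε-reg) (proj₁ σ-aut))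
      (surjective-∘ (regEpi⇒surjective A C ε-reg) (aut-surjective C σ-aut))
      (generating-∘ A C C (regEpi⇒generating A C ε-reg) (aut-generating C σ-aut))

  M-∘-aut : ∀ {σ μ} → IsAut C σ → IsMono C B μ → IsMono C B (μ ∘ σ)
  M-∘-aut σ-aut μ-mono =
    injective⇒mono C B (isMor-∘ C C B (proj₁ σ-aut) (proj₁ μ-mono))
      (Composition.injective _≡_ _≡_ _≡_ (aut-injective C σ-aut) (mono⇒injective C B μ-mono))

  factorise : ∀ {f} → ImageGenerated A B C f → Factorisation A B C (IsRegEpi A C) (IsMono C B) f
  factorise {f} (f-mor , I) = factorisation corestriction embedding
    (surjective-generating⇒regEpi A C corestriction-isMor corestriction-surjective
                                      corestriction-generating)
    (injective⇒mono C B embedding-isMor embedding-injective)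
    factors
    where
    open Image A B C (λ o → TransClosure (ImRel f (order A o))) I
    embedding-isMor : IsMor C B embedding
    embedding-isMor = isMor C B λ o r →
      closure-image-⊆ {S = order B o} (monotone f-mor o) (order-trans B o) (embedding-order⁺ o r)
    corestriction-isMor : IsMor A C corestriction
    corestriction-isMor = isMor A C λ o r →
      embedding-order⁻ o (closure-image-map {g = embedding} factors [ ImRel-image r ])
    corestriction-generating : Generating A C corestriction
    corestriction-generating o r =
      closure-image-pullback embedding-injective factors (embedding-order⁺ o r)

  compose : ∀ {ε μ} → IsRegEpi A C ε → IsMono C B μ → ImageGenerated A B C (μ ∘ ε)
  compose {ε} {μ} ε-reg μ-mono = isMor-∘ A C B ε-mor (proj₁ μ-mono)
    , imageIso-∘ A B C (λ o → TransClosure (ImRel (μ ∘ ε) (order A o)))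
        (regEpi⇒surjective A C ε-reg) μ-injective
        (λ o r → closure-image-map (λ _ → refl) (regEpi⇒generating A C ε-reg o r))
        (λ o r → closure-image-⊆ (monotone ε-mor o) (order-trans C o)
                   (closure-image-pullback μ-injective (λ _ → refl) r))
    where
    ε-mor : IsMor A C ε
    ε-mor = regEpi-isMor A C ε-reg
    μ-injective : Injective _≡_ _≡_ μ
    μ-injective = mono⇒injective C B μ-mono

theoremB12 : (A B C : DPoset) →
    (∀ (k e r a : ℕ) →
    HasCount (ImageInduced A B C) k → HasCount (IsEpi A C) e →
    HasCount (IsRegMono C B) r → HasCount (IsAut C) a →
    k * a ≡ e * r)
    ×
    (∀ (k e r a : ℕ) →
    HasCount (ImageGenerated A B C) k → HasCount (IsRegEpi A C) e →
    HasCount (IsMono C B) r → HasCount (IsAut C) a →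
    k * a ≡ e * r)
theoremB12 A B C =
    (λ _ _ _ _ → factorisation-count (epi-regMono-factorisation A B C))
  , (λ _ _ _ _ → factorisation-count (regEpi-mono-factorisation A B C))
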